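{- Let $F$ be a tract, $\mathcal M$ a strong $F$-matroid on a finite set $E$, and $e\in E$. Then $\{X\in F^{E-\{e\}}:\ Xe^0\in\mathcal V^*(\mathcal M)\}\subseteq\mathcal V^*(\mathcal M/e)$.
   Context: A tract is a multiplicative group $G$ with $N_G\subseteq\mathbb N[G]$ such that $0\in N_G$, $1\notin N_G$, there is a unique $\eta\in G$ with $1+\eta\in N_G$, and $N_G$ is closed under multiplication by $G$; $F=G\cup\{0\}$, $-g=\eta g$, $\boxplus_ja_j=\{b:-b+\sum_ja_j\in N_G\}$, extended componentwise to $F^E$. $F$ has a conjugation $x\mapsto x^c$ (involutive automorphism). Inner product $X\cdot Y=\sum_eX(e)Y(e)^c$; $X\perp Y$ iff $X\cdot Y\in N_G$; $S^\perp$ is the set of vectors orthogonal to all of $S$. $\underline X$ is the support, $\mathrm{Minsupp}(S)$ the elements of $S$ of minimal support. A strong $F$-matroid $\mathcal M$ on $E$ is given by its set $\mathcal C(\mathcal M)\subseteq F^E$ of $F$-circuits satisfying: $\mathbf 0\notin\mathcal C$; $G\mathcal C=\mathcal C$; comparable supports imply scalar multiples; and strong modular elimination (for a modular family $\{X_1,\dots,X_k,X\}\subseteq\mathcal C$ with $\underline X\not\subseteq\bigcup\underline{X_j}$ and $e_j\in(\underline X\cap\underline{X_j})\setminus\bigcup_{l\neq j}\underline{X_l}$, $X(e_j)=-X_j(e_j)$, there is $Z\in\mathcal C\cap(X\boxplus\boxplus_jX_j)$ with $Z(e_j)=0$ for all $j$; modular means the supports are atoms of the lattice of unions of circuit supports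 whose join has height equal to the family size). The $F$-covectors are $\mathcal V^*(\mathcal M)=\mathcal C(\mathcal M)^\perp$. For $X\in F^{E-\{e\}}$, $Xe^0\in F^E$ is the extension of $X$ with value $0$ at $e$; for $Y\in F^E$, $Y\backslash e$ is its restriction to $E-\{e\}$. The contraction $\mathcal M/e$ is the strong $F$-matroid on $E-\{e\}$ whose $F$-circuit set is $\mathrm{Minsupp}(\{Y\backslash e: Y\in\mathcal C(\mathcal M)\}-\{\mathbf 0\})$ (Baker–Bowler). -}

module Defs where

open import Level using (0ℓ)
open import Data.Nat using (ℕ; zero; suc; _≤_)
open import Data.Fin using (Fin; zero; suc; _≟_; punchIn; fromℕ; inject₁)
open import Data.Fin.Subset using (Subset; inside; outside; _⊆_; _⊂_; _∪_; ⋃; _∈_; _∉_; _∩_; Nonempty)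
import Data.Fin.Subset as Sub
open import Data.Maybe using (Maybe; just; nothing)
open import Data.List using (List; []; _∷_; map; catMaybes; tabulate)
open import Data.List.Relation.Unary.All using (All)
open import Data.List.Relation.Binary.Permutation.Propositional using (_↭_)
open import Data.Vec.Functional using (insertAt; removeAt)
import Data.Vec as Vec
open import Data.Product using (Σ; ∃; _×_; _,_)
open import Data.Sum using (_⊎_)
open import Data.Empty using (⊥)
open import Relation.Nullary using (¬_)
open import Relation.Binary.PropositionalEquality using (_≡_; _≢_)
open import Algebra.Structures using (IsAbelianGroup)

-- A tract (Baker–Bowler).  ℕ[G] is represented by finite lists of elements
-- of G (formal sums), the null set N_G being a permutation-invariant predicate.
record Tract : Set₁ where
  field
    G     : Set
    _·_   : G → G → G
    one   : G
    inv   : G → G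
    isAbelianGroup : IsAbelianGroup _≡_ _·_ one inv
    N     : List G → Set
    N-perm : ∀ {xs ys} → xs ↭ ys → N xs → N ys -- formal sums are unordered
    N-zero : N []
    N-one  : ¬ N (one ∷ [])
    η      : G
    N-η    : N (one ∷ η ∷ [])
    η-uniq : ∀ g → N (one ∷ g ∷ []) → g ≡ η
    N-mul  : ∀ g xs → N xs → N (map (g ·_) xs)
    conj       : G → G
    conj-hom   : ∀ g h → conj (g · h) ≡ conj g · conj h
    conj-invol : ∀ g → conj (conj g) ≡ g
    conj-N     : ∀ xs → N xs → N (map conj xs)

module TractTheory (T : Tract) where
  open Tract T

  F : Set
  F = Maybe G

  0F : F
  0F = nothing

  _*F_ : F → F → F
  just a *F just b = just (a · b)
  _ *F _ = nothing

  negF : F → F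
  negF x = just η *F x

  conjF : F → F
  conjF (just a) = just (conj a)
  conjF nothing  = nothing

  NF : List F → Set
  NF xs = N (catMaybes xs)

  Vect : ℕ → Set
  Vect m = Fin m → F

  scale : ∀ {m} → G → Vect m → Vect m
  scale g X i = just g *F X i

  supp : ∀ {m} → Vect m → Subset m
  supp X = Vec.tabulate λ i → suppAt (X i)
    where
    suppAt : F → Data.Fin.Subset.Side
    suppAt (just _) = inside
    suppAt nothing  = outside

  isZeroVec : ∀ {m} → Vect m → Set
  isZeroVec X = ∀ i → X i ≡ nothing

  inner : ∀ {m} → Vect m → Vect m → List F
  inner X Y = tabulate λ i → X i *F conjF (Y i)

  _⊥F_ : ∀ {m} → Vect m → Vect m → Set
  X ⊥F Y = NF (inner X Y)

  Perp : ∀ {m} → (Vect m → Set) → Vect m → Set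
  Perp S X = ∀ Y → S Y → X ⊥F Y

  -- b ∈ x₀ ⊞ x₁ ⊞ ... ⊞ x_k   iff  -b + Σ xⱼ ∈ N_G
  InBoxSum : F → List F → Set
  InBoxSum b xs = NF (negF b ∷ xs)

  module CircuitLattice {m : ℕ} (C : Vect m → Set) where

    -- elements of the lattice of unions of circuit supports
    InL : Subset m → Set
    InL S = Σ (List (Vect m)) λ Xs → All C Xs × ⋃ (map supp Xs) ≡ S

    Atom : Subset m → Set
    Atom S = InL S × Nonempty S × (∀ T → InL T → T ⊆ S → T ≡ Sub.⊥ ⊎ T ≡ S)

    Chain : ℕ → Subset m → Set
    Chain h S = Σ (Fin (suc h) → Subset m) λ c →
                  c zero ≡ Sub.⊥ × c (fromℕ h) ≡ S ×
                  (∀ i → InL (c i)) ×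
                  (∀ (i : Fin h) → c (inject₁ i) ⊂ c (suc i))

    Height : Subset m → ℕ → Set
    Height S h = Chain h S × (∀ h' → Chain h' S → h' ≤ h)

    Modular : (k : ℕ) → (Fin k → Vect m) → Vect m → Set
    Modular k Xs X = Atom (supp X) × (∀ j → Atom (supp (Xs j)))
                     × Height (supp X ∪ ⋃ (tabulate λ j → supp (Xs j))) (suc k)

  record IsStrongMatroid {m : ℕ} (C : Vect m → Set) : Set where
    open CircuitLattice C
    field
      zero-not : ∀ X → C X → ¬ isZeroVec X
      scale-closed : ∀ g X → C X → C (scale g X)
      comparable : ∀ X Y → C X → C Y → supp X ⊆ supp Y →
                   Σ G λ g → ∀ i → Y i ≡ scale g X i
      strong-modular-elim :
        ∀ (k : ℕ) (Xs : Fin k → Vect m) (X : Vect m) →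
        (∀ j → C (Xs j)) → C X → Modular k Xs X →
        ¬ (supp X ⊆ ⋃ (tabulate λ j → supp (Xs j))) →
        (es : Fin k → Fin m) →
        (∀ j → es j ∈ supp X) → (∀ j → es j ∈ supp (Xs j)) →
        (∀ j l → j ≢ l → es j ∉ supp (Xs l)) →
        (∀ j → X (es j) ≡ negF (Xs j (es j))) →
        Σ (Vect m) λ Z → C Z ×
          (∀ i → InBoxSum (Z i) (X i ∷ tabulate λ j → Xs j i)) ×
          (∀ j → Z (es j) ≡ nothing)

  Covectors : ∀ {m} → (Vect m → Set) → Vect m → Set
  Covectors C = Perp C

  ext0 : ∀ {n} → Fin (suc n) → Vect n → Vect (suc n)
  ext0 e X = insertAt X e nothing

  restr : ∀ {n} → Fin (suc n) → Vect (suc n) → Vect n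
  restr e Y = removeAt Y e

  Minsupp : ∀ {m} → (Vect m → Set) → Vect m → Set
  Minsupp S W = S W × (∀ V → S V → ¬ (supp V ⊂ supp W))

  contractCircuits : ∀ {n} → (Vect (suc n) → Set) → Fin (suc n) → Vect n → Set
  contractCircuits C e = Minsupp λ W →
    (Σ (Vect _) λ Y → C Y × (∀ i → W i ≡ restr e Y i)) × ¬ isZeroVec W

module Submission where

open import Defs
open import Data.Nat using (ℕ; suc)
open import Data.Fin using (Fin; zero; suc)
open import Data.Maybe using (Maybe; just; nothing)
open import Data.List using (List; _∷_; catMaybes; tabulate)
open import Data.List.Properties using (tabulate-cong)
open import Data.Product using (_,_)
open import Data.Vec.Functional using (removeAt)
open import Data.Vec.Functional.Properties using (insertAt-lookup; insertAt-punchIn)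
open import Relation.Binary.PropositionalEquality using (_≡_; refl; sym; cong; subst)

-- Orthogonality only sees the nonzero terms of the inner product, and
-- the e-th term of Xe⁰ · Y vanishes; so Xe⁰ ⊥ Y iff X ⊥ Y∖e.  Hence Xe⁰ is
-- orthogonal to C(M) only if X is orthogonal to every restriction of a
-- circuit, and in particular to the circuits of M/e.

catMaybes-∷-cong : ∀ {A : Set} (x : Maybe A) {xs ys : List (Maybe A)} →
  catMaybes xs ≡ catMaybes ys → catMaybes (x ∷ xs) ≡ catMaybes (x ∷ ys)
catMaybes-∷-cong (just a) eq = cong (a ∷_) eq
catMaybes-∷-cong nothing  eq = eq

catMaybes-tabulate-removeAt : ∀ {A : Set} {n : ℕ} (f : Fin (suc n) → Maybe A)
  (e : Fin (suc n)) → f e ≡ nothing →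
  catMaybes (tabulate f) ≡ catMaybes (tabulate (removeAt f e))
catMaybes-tabulate-removeAt f zero fe≡nothing
  rewrite fe≡nothing = refl
catMaybes-tabulate-removeAt {n = suc n} f (suc e) fe≡nothing =
  catMaybes-∷-cong (f zero)
    {tabulate (λ i → f (suc i))} {tabulate (removeAt (λ i → f (suc i)) e)}
    (catMaybes-tabulate-removeAt (λ i → f (suc i)) e fe≡nothing)

module Orthogonality (T : Tract) where
  open Tract T
  open TractTheory T

  ⊥F-congʳ : ∀ {m} (X : Vect m) {Y Y′ : Vect m} →
    (∀ i → Y i ≡ Y′ i) → X ⊥F Y → X ⊥F Y′
  ⊥F-congʳ X Y≗Y′ =
    subst N (cong catMaybes (tabulate-cong λ i → cong (λ y → X i *F conjF y) (Y≗Y′ i)))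

  catMaybes-inner-ext0 : ∀ {n} (e : Fin (suc n)) (X : Vect n) (Y : Vect (suc n)) →
    catMaybes (inner (ext0 e X) Y) ≡ catMaybes (inner X (restr e Y))
  catMaybes-inner-ext0 e X Y
    rewrite catMaybes-tabulate-removeAt (λ i → ext0 e X i *F conjF (Y i)) e
              (cong (_*F conjF (Y e)) (insertAt-lookup X e nothing))
    = cong catMaybes (tabulate-cong λ j →
        cong (_*F conjF (restr e Y j)) (insertAt-punchIn X e nothing j))

  ext0-⊥F⇒⊥F-restr : ∀ {n} (e : Fin (suc n)) (X : Vect n) (Y : Vect (suc n)) →
    ext0 e X ⊥F Y → X ⊥F restr e Y
  ext0-⊥F⇒⊥F-restr e X Y = subst N (catMaybes-inner-ext0 e X Y)

proposition4p3 : (T : Tract) → let open TractTheory T in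
    (n : ℕ) (C : Vect (suc n) → Set) → IsStrongMatroid C →
    (e : Fin (suc n)) (X : Vect n) →
    Covectors C (ext0 e X) → Covectors (contractCircuits C e) X
proposition4p3 T n C _ e X Xe⁰-covector W (((Y , Y∈C , W≗Y∖e) , _) , _) =
  ⊥F-congʳ X (λ i → sym (W≗Y∖e i)) (ext0-⊥F⇒⊥F-restr e X Y (Xe⁰-covector Y Y∈C))
  where open Orthogonality T
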